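{- Let $\mathbf g,\mathbf h,\mathbf i,\mathbf j,\mathbf k,\mathbf l,\mathbf m,\mathbf q,\mathbf r\in E$ with $(\mathbf g,\mathbf h,\mathbf i),(\mathbf j,\mathbf k,\mathbf l),(\mathbf m,\mathbf q,\mathbf r)\in\mathbb{P}$. Then $(\mathbf g,[\mathbf g,\mathbf h,\mathbf i,\mathbf k,\mathbf l],\mathbf l)\in\mathbb{P}$, and the coefficient of $B_{\mathbf m,\mathbf q,\mathbf r}$ in the expansion of $B_{\mathbf g,\mathbf h,\mathbf i}B_{\mathbf j,\mathbf k,\mathbf l}$ with respect to the basis $\{B_{\mathbf a,\mathbf b,\mathbf c}:(\mathbf a,\mathbf b,\mathbf c)\in\mathbb{P}\}$ of $\mathbb{T}$ equals $\delta_{\mathbf i,\mathbf j}\delta_{\mathbf m,\mathbf g}\delta_{\mathbf q,[\mathbf g,\mathbf h,\mathbf i,\mathbf k,\mathbf l]}\delta_{\mathbf r,\mathbf l}\,\overline{k_{\mathbf h\cap\mathbf i\cap\mathbf k}}$.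
   Context: Let $\mathbb{F}$ be a field; $\overline m$ is the image in $\mathbb{F}$ of an integer $m$ and $\delta$ is the Kronecker delta with values in $\mathbb{F}$. Let $n\ge 1$ and let $U_1,\dots,U_n$ be finite sets with $|U_h|\ge 2$. Put $X=U_1\times\cdots\times U_n$ and $E=\{0,1\}^n$. For $\mathbf g\in E$ let $S(\mathbf g)=\{a:\mathbf g_a=1\}$; $\mathbf g\cap\mathbf h\cap\mathbf i$ is the element of $E$ with support $S(\mathbf g)\cap S(\mathbf h)\cap S(\mathbf i)$. For $V\subseteq\{1,\dots,n\}$ let $V^\circ=\{a\in V:|U_a|>2\}$. Let $R_{\mathbf g}=\{(\mathbf y,\mathbf z)\in X\times X:\ \mathbf y_a\neq\mathbf z_a\iff\mathbf g_a=1\}$ and $k_{\mathbf g}=\prod_{a\in S(\mathbf g)}(|U_a|-1)$ ($k_{\mathbf 0}=1$). Let $A_{\mathbf g}\in\mathrm{M}_X(\mathbb{F})$ be the $\{0,1\}$ adjacency matrix of $R_{\mathbf g}$. Fix $\mathbf x\in X$ and let $E^*_{\mathbf g}$ be the diagonal matrix with $(\mathbf y,\mathbf y)$-entry $1$ iff $(\mathbf x,\mathbf y)\in R_{\mathbf g}$, else $0$. $\mathbb{T}$ is the $\mathbb{F}$-subalgebra of $\mathrm{M}_X(\mathbb{F})$ generated by all $A_{\mathbf g},E^*_{\mathbf g}$. Let $\mathbb{P}$ be the set of $(\mathbf a,\mathbf b,\mathbf c)\in E^3$ with $S(\mathbf a)\triangle S(\mathbf c)\subseteq S(\mathbf b)\subseteq(S(\mathbf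 a)\triangle S(\mathbf c))\cup(S(\mathbf a)\cap S(\mathbf c))^\circ$. For $(\mathbf g,\mathbf h,\mathbf i)\in\mathbb{P}$ let $B_{\mathbf g,\mathbf h,\mathbf i}=\sum_{\mathbf j}E^*_{\mathbf g}A_{\mathbf j}E^*_{\mathbf i}$ over all $\mathbf j\in E$ with $S(\mathbf g)\triangle S(\mathbf i)\subseteq S(\mathbf j)\subseteq S(\mathbf h)$; these form an $\mathbb{F}$-basis of $\mathbb{T}$. For $\mathbf g,\mathbf h,\mathbf i,\mathbf j,\mathbf k\in E$, $[\mathbf g,\mathbf h,\mathbf i,\mathbf j,\mathbf k]$ denotes the element of $E$ with support $(S(\mathbf g)\triangle S(\mathbf k))\cup\big((S(\mathbf g)\cap S(\mathbf k))^\circ\setminus S(\mathbf i)\big)\cup\big((S(\mathbf h)\cup S(\mathbf j))\cap(S(\mathbf g)\cap S(\mathbf i)\cap S(\mathbf k))^\circ\big)$. -}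

module Defs where

open import Level using (Level; _⊔_; suc)
open import Algebra.Bundles using (CommutativeRing)
open import Data.Nat as ℕ using (ℕ; _∸_; _<?_)
open import Data.Fin as Fin using (Fin)
open import Data.Fin.Properties using (all?)
open import Data.Bool using (Bool; true; false; T; _∧_; _∨_; _xor_; not; if_then_else_)
open import Data.Bool.Properties using (T?)
open import Data.Vec using (Vec; []; _∷_; lookup; zipWith; tabulate)
open import Data.Vec.Properties using (≡-dec)
open import Data.List as List using (List; []; _∷_; concatMap; allFin; foldr)
open import Data.Product using (_×_; _,_; ∃)
open import Relation.Nullary using (¬_; Dec; yes; no; _→-dec_; _×-dec_)
open import Relation.Nullary.Decidable using (⌊_⌋)
open import Relation.Binary.PropositionalEquality using (_≡_)
import Data.Bool.Properties as BoolP
import Data.Nat.ListAction as NatL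
import Data.Bool.ListAction as BoolL
import Data.Fin.Properties as FinP

record Field (c ℓ : Level) : Set (Level.suc (c ⊔ ℓ)) where
  field
    commutativeRing : CommutativeRing c ℓ
  open CommutativeRing commutativeRing public
  field
    1≉0     : ¬ (1# ≈ 0#)
    inverse : ∀ x → ¬ (x ≈ 0#) → ∃ λ y → x * y ≈ 1#

-- The set E = {0,1}^n, as boolean vectors; S(g) = { a | lookup g a = true }.

E : ℕ → Set
E n = Vec Bool n

allE : (n : ℕ) → List (E n)
allE ℕ.zero    = [] ∷ []
allE (ℕ.suc n) = List.map (true ∷_) (allE n) List.++ List.map (false ∷_) (allE n)

_△_ : ∀ {n} → E n → E n → E n
_△_ = zipWith _xor_

_∩_ : ∀ {n} → E n → E n → E n
_∩_ = zipWith _∧_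

_∪_ : ∀ {n} → E n → E n → E n
_∪_ = zipWith _∨_

_∖_ : ∀ {n} → E n → E n → E n
_∖_ = zipWith (λ u v → u ∧ not v)

_⊆_ : ∀ {n} → E n → E n → Set
_⊆_ {n} g h = (a : Fin n) → T (lookup g a) → T (lookup h a)

_⊆?_ : ∀ {n} (g h : E n) → Dec (g ⊆ h)
g ⊆? h = all? (λ a → T? (lookup g a) →-dec T? (lookup h a))

-- The sizes |U_a| = s a; U_a = Fin (s a); X = U_1 × ... × U_n.

X : (n : ℕ) → (Fin n → ℕ) → Set
X n s = (a : Fin n) → Fin (s a)

allX : (n : ℕ) (s : Fin n → ℕ) → List (X n s)
allX ℕ.zero    s = (λ ()) ∷ []
allX (ℕ.suc n) s =
  concatMap (λ v → List.map (λ f → λ { Fin.zero → v ; (Fin.suc a) → f a })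
                            (allX n (λ a → s (Fin.suc a))))
            (allFin (s Fin.zero))

_° : ∀ {n} {s : Fin n → ℕ} → E n → E n
_° {n} {s} V = tabulate (λ a → lookup V a ∧ ⌊ 2 <? s a ⌋)

bracket : ∀ {n} (s : Fin n → ℕ) (g h i j k : E n) → E n
bracket s g h i j k =
  (g △ k) ∪ ((_° {s = s} (g ∩ k) ∖ i) ∪ ((h ∪ j) ∩ _° {s = s} ((g ∩ i) ∩ k)))

kk : ∀ {n} (s : Fin n → ℕ) → E n → ℕ
kk {n} s g = NatL.product (List.map (λ a → if lookup g a then s a ∸ 1 else 1) (allFin n))

ℙ : ∀ {n} (s : Fin n → ℕ) → E n → E n → E n → Set
ℙ s a b c = ((a △ c) ⊆ b) × (b ⊆ ((a △ c) ∪ _° {s = s} (a ∩ c)))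

ℙ? : ∀ {n} (s : Fin n → ℕ) (a b c : E n) → Dec (ℙ s a b c)
ℙ? s a b c = ((a △ c) ⊆? b) ×-dec (b ⊆? ((a △ c) ∪ _° {s = s} (a ∩ c)))

R : ∀ {n} {s : Fin n → ℕ} → E n → X n s → X n s → Bool
R {n} g y z = BoolL.and (List.map (λ a → ⌊ not ⌊ y a FinP.≟ z a ⌋ BoolP.≟ lookup g a ⌋) (allFin n))

eqX : ∀ {n} {s : Fin n → ℕ} → X n s → X n s → Bool
eqX {n} y z = BoolL.and (List.map (λ a → ⌊ y a FinP.≟ z a ⌋) (allFin n))

module Setup {c ℓ : Level} (𝔽 : Field c ℓ) (n : ℕ) (s : Fin n → ℕ) (x : X n s) where
  open Field 𝔽

  Mat : Set c
  Mat = X n s → X n s → Carrier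

  _≈ₘ_ : Mat → Mat → Set ℓ
  M ≈ₘ N = ∀ y z → M y z ≈ N y z

  ΣL : ∀ {A : Set} → List A → (A → Carrier) → Carrier
  ΣL xs f = foldr (λ a r → f a + r) 0# xs

  0ₘ : Mat
  0ₘ _ _ = 0#

  _⊕_ : Mat → Mat → Mat
  (M ⊕ N) y z = M y z + N y z

  _⊗_ : Mat → Mat → Mat
  (M ⊗ N) y z = ΣL (allX n s) (λ w → M y w * N w z)

  _•_ : Carrier → Mat → Mat
  (t • M) y z = t * M y z

  ΣM : ∀ {A : Set} → List A → (A → Mat) → Mat
  ΣM xs f = foldr (λ a M → f a ⊕ M) 0ₘ xs

  ι : ℕ → Carrier
  ι ℕ.zero    = 0#
  ι (ℕ.suc m) = 1# + ι m

  δ : E n → E n → Carrier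
  δ g h = if ⌊ ≡-dec BoolP._≟_ g h ⌋ then 1# else 0#

  A : E n → Mat
  A g y z = if R g y z then 1# else 0#

  E* : E n → Mat
  E* g y z = if eqX y z ∧ R g x y then 1# else 0#

  B : E n → E n → E n → Mat
  B g h i = ΣM (List.filter (λ j → ((g △ i) ⊆? j) ×-dec (j ⊆? h)) (allE n))
               (λ j → (E* g ⊗ A j) ⊗ E* i)

  ℙlist : List (E n × E n × E n)
  ℙlist = List.filter (λ { (a , b , c) → ℙ? s a b c })
            (concatMap (λ a → concatMap (λ b → List.map (λ c → (a , b , c)) (allE n)) (allE n)) (allE n))

-- All matrices involved are tensor products over the n coordinates: the entries of E*_g and A_j,
-- hence of B_{g,h,i}, are products of factors that only see the a-th entries, and products of such
-- matrices are again computed coordinatewise. Both sides of the expansion are evaluated at an entry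
-- (y,z) for which x ≠ y, y ≠ z, x ≠ z hold exactly on the supports of m, q, r. There the product
-- becomes a product of one-coordinate counts, which equal δ_{i,j} δ_{m,g} δ_{r,l} [q ⊆ [g,h,i,k,l]]
-- times the coordinate's share of k_{h∩i∩k} (by evaluation when |U_a| = 2, by counting the points t
-- according to whether t ∈ {x, y, z} otherwise), while the expansion becomes the sum of the
-- coefficients of the B_{m,e,r} with e ⊇ q. Möbius inversion over supersets isolates each coefficient.
module Submission where

open import Defs
open import Level using (Level)
open import Algebra.Bundles using (CommutativeSemiring; CommutativeRing)
open import Data.Bool using (Bool; true; false; T; _∧_; _∨_; _xor_; not; if_then_else_)
open import Data.Bool.Properties using (T?)
import Data.Bool.Properties as BoolP
import Data.Bool.ListAction as BoolL
open import Data.Fin using (Fin; zero; suc)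
import Data.Fin.Properties as FinP
open import Data.List as List using (List; []; _∷_; _++_; foldr; allFin; concatMap; filter)
import Data.List.Properties as ListP
open import Data.Nat using (ℕ; zero; suc; _≤_; _<_; s≤s; z≤n)
import Data.Nat as Nat
import Data.Nat.Properties as ℕP
open import Data.Nat.Tactic.RingSolver using (solve-∀)
open import Data.Product using (_×_; _,_; proj₁; proj₂)
open import Data.Vec using (Vec; []; _∷_; lookup)
import Data.Vec.Functional as Vector
import Data.Vec.Properties as VecP
open import Function using (_∘_; id)
open import Function.Bundles using (Equivalence)
open import Relation.Binary.PropositionalEquality as ≡ using (_≡_; _≢_)
open import Relation.Nullary using (Dec; does; yes; no; _×-dec_; _→-dec_)
open import Relation.Nullary.Decidable using (⌊_⌋; isYes≗does; does-≡; dec-true; dec-false; map′; from-yes)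
open import Relation.Nullary.Negation using (contradiction)
open import Relation.Unary using (Decidable)

from-does : ∀ {p} {P : Set p} (P? : Dec P) → T (does P?) → P
from-does (yes p) _ = p

∀-Bool? : ∀ {p} {P : Bool → Set p} → Decidable P → Dec (∀ b → P b)
∀-Bool? P? =
  map′ (λ (pt , pf) → λ { true → pt ; false → pf }) (λ h → h true , h false) (P? true ×-dec P? false)

allᵇ : ∀ {n} → (Fin n → Bool) → Bool
allᵇ = Vector.foldr _∧_ true

does-all? : ∀ {n p} {P : Fin n → Set p} (P? : Decidable P) →
            does (FinP.all? P?) ≡ allᵇ (λ a → does (P? a))
does-all? {zero}  P? = ≡.refl
does-all? {suc n} P? = ≡.cong (does (P? zero) ∧_) (does-all? (P? ∘ suc))

foldr-map-allFin : ∀ {n} {A B : Set} (f : A → B → B) (e : B) (p : Fin n → A) →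
                   foldr f e (List.map p (allFin n)) ≡ Vector.foldr f e p
foldr-map-allFin {zero}  f e p = ≡.refl
foldr-map-allFin {suc n} f e p = ≡.cong (f (p zero)) (begin
  foldr f e (List.map p (List.tabulate suc))  ≡⟨ ≡.cong (foldr f e) (ListP.map-tabulate suc p) ⟩
  foldr f e (List.tabulate (p ∘ suc))         ≡⟨ ≡.cong (foldr f e) (ListP.map-tabulate id (p ∘ suc)) ⟨
  foldr f e (List.map (p ∘ suc) (allFin n))   ≡⟨ foldr-map-allFin f e (p ∘ suc) ⟩
  Vector.foldr f e (p ∘ suc)                  ∎)
  where open ≡.≡-Reasoning

_⇒ᵇ_ : Bool → Bool → Bool
b ⇒ᵇ b′ = not b ∨ b′

⇒ᵇ-intro : ∀ b b′ → (T b → T b′) → T (b ⇒ᵇ b′)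
⇒ᵇ-intro true  b′ f = f _
⇒ᵇ-intro false b′ f = _

⇒ᵇ-elim : ∀ b b′ → T (b ⇒ᵇ b′) → T b → T b′
⇒ᵇ-elim true b′ t _ = t

_≐_ : Bool → Bool → Bool
b ≐ b′ = ⌊ b BoolP.≟ b′ ⌋

_≠ᵇ_ : ∀ {S} → Fin S → Fin S → Bool
u ≠ᵇ v = not ⌊ u FinP.≟ v ⌋

_≟ᴱ_ : ∀ {n} (u v : E n) → Dec (u ≡ v)
_≟ᴱ_ = VecP.≡-dec BoolP._≟_

module Sums {c ℓ} (R : CommutativeSemiring c ℓ) where
  open CommutativeSemiring R hiding (zero)
  open import Relation.Binary.Reasoning.Setoid setoid
  open import Algebra.Properties.CommutativeMonoid.Sum *-commutativeMonoid public
    using () renaming (sum to ∏; ∑-distrib-+ to ∏-distrib-*; sum-cong-≋ to ∏-cong)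
  open import Algebra.Properties.CommutativeSemigroup +-commutativeSemigroup using ()
    renaming (interchange to +-interchange)

  𝟙 : Bool → Carrier
  𝟙 b = if b then 1# else 0#

  ∑ : ∀ {A : Set} → List A → (A → Carrier) → Carrier
  ∑ xs f = foldr (λ a r → f a + r) 0# xs

  𝟙-∧ : ∀ b b′ → 𝟙 (b ∧ b′) ≈ 𝟙 b * 𝟙 b′
  𝟙-∧ true  b′ = sym (*-identityˡ _)
  𝟙-∧ false b′ = sym (zeroˡ _)

  𝟙-absorb : ∀ b b₁ b₂ → (T b₁ → T b₂ → T b) → 𝟙 b * (𝟙 b₁ * 𝟙 b₂) ≈ 𝟙 b₁ * 𝟙 b₂
  𝟙-absorb b true  true  h with b | h _ _
  ... | true | _ = *-identityˡ _
  𝟙-absorb b true  false h = trans (*-congˡ (zeroʳ 1#)) (trans (zeroʳ _) (sym (zeroʳ 1#)))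
  𝟙-absorb b false b₂    h = trans (*-congˡ (zeroˡ _)) (trans (zeroʳ _) (sym (zeroˡ _)))

  𝟙-guard : ∀ b b′ {u v} → (T b → T b′ → u ≈ v) → 𝟙 b * (𝟙 b′ * u) ≈ 𝟙 b * (𝟙 b′ * v)
  𝟙-guard true  true  u≈v = *-congˡ (*-congˡ (u≈v _ _))
  𝟙-guard true  false u≈v = *-congˡ (trans (zeroˡ _) (sym (zeroˡ _)))
  𝟙-guard false b′    u≈v = trans (zeroˡ _) (sym (zeroˡ _))

  ∏-distrib-*₄ : ∀ {n} (f g h k : Fin n → Carrier) →
                 ∏ (λ a → ((f a * g a) * h a) * k a) ≈ ((∏ f * ∏ g) * ∏ h) * ∏ k
  ∏-distrib-*₄ {n} f g h k =
    trans (∏-distrib-* {n} _ k) (*-congʳ (trans (∏-distrib-* {n} _ h) (*-congʳ (∏-distrib-* {n} f g))))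

  𝟙-allᵇ : ∀ {n} (p : Fin n → Bool) → 𝟙 (allᵇ p) ≈ ∏ (𝟙 ∘ p)
  𝟙-allᵇ {zero}  p = refl
  𝟙-allᵇ {suc n} p = trans (𝟙-∧ (p zero) _) (*-congˡ (𝟙-allᵇ (p ∘ suc)))

  𝟙-and-allFin : ∀ {n} (p : Fin n → Bool) → 𝟙 (BoolL.and (List.map p (allFin n))) ≈ ∏ (𝟙 ∘ p)
  𝟙-and-allFin p = trans (reflexive (≡.cong 𝟙 (foldr-map-allFin _∧_ true p))) (𝟙-allᵇ p)

  𝟙-⊆? : ∀ {n} (d e : E n) → 𝟙 (does (d ⊆? e)) ≈ ∏ (λ a → 𝟙 (lookup d a ⇒ᵇ lookup e a))
  𝟙-⊆? d e = trans (reflexive (≡.cong 𝟙 (does-all? (λ a → T? (lookup d a) →-dec T? (lookup e a)))))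
                    (𝟙-allᵇ (λ a → lookup d a ⇒ᵇ lookup e a))

  𝟙-≟ᴱ : ∀ {n} (u v : E n) → 𝟙 (does (u ≟ᴱ v)) ≈ ∏ (λ a → 𝟙 (lookup u a ≐ lookup v a))
  𝟙-≟ᴱ []      []      = refl
  𝟙-≟ᴱ (b ∷ u) (c ∷ v) = trans (𝟙-∧ (does (b BoolP.≟ c)) _)
    (*-cong (reflexive (≡.cong 𝟙 (≡.sym (isYes≗does (b BoolP.≟ c))))) (𝟙-≟ᴱ u v))

  module _ {A : Set} where

    ∑-cong : ∀ (xs : List A) {f g : A → Carrier} → (∀ a → f a ≈ g a) → ∑ xs f ≈ ∑ xs g
    ∑-cong []       f≈g = refl
    ∑-cong (x ∷ xs) f≈g = +-cong (f≈g x) (∑-cong xs f≈g)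

    ∑-++ : ∀ (xs ys : List A) f → ∑ (xs ++ ys) f ≈ ∑ xs f + ∑ ys f
    ∑-++ []       ys f = sym (+-identityˡ _)
    ∑-++ (x ∷ xs) ys f = trans (+-congˡ (∑-++ xs ys f)) (sym (+-assoc _ _ _))

    ∑-map : ∀ {B : Set} (h : B → A) (xs : List B) f → ∑ (List.map h xs) f ≈ ∑ xs (f ∘ h)
    ∑-map h []       f = refl
    ∑-map h (x ∷ xs) f = +-congˡ (∑-map h xs f)

    ∑-concatMap : ∀ {B : Set} (h : B → List A) (xs : List B) f →
                  ∑ (concatMap h xs) f ≈ ∑ xs (λ b → ∑ (h b) f)
    ∑-concatMap h []       f = refl
    ∑-concatMap h (x ∷ xs) f = trans (∑-++ (h x) _ f) (+-congˡ (∑-concatMap h xs f))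

    ∑-filter : ∀ {p} {P : A → Set p} (P? : Decidable P) xs f →
               ∑ (filter P? xs) f ≈ ∑ xs (λ a → 𝟙 (does (P? a)) * f a)
    ∑-filter P? []       f = refl
    ∑-filter P? (x ∷ xs) f with does (P? x)
    ... | true  = +-cong (sym (*-identityˡ _)) (∑-filter P? xs f)
    ... | false = trans (∑-filter P? xs f) (trans (sym (+-identityˡ _)) (+-congʳ (sym (zeroˡ _))))

    *-distribˡ-∑ : ∀ k (xs : List A) f → k * ∑ xs f ≈ ∑ xs (λ a → k * f a)
    *-distribˡ-∑ k []       f = zeroʳ k
    *-distribˡ-∑ k (x ∷ xs) f = trans (distribˡ k _ _) (+-congˡ (*-distribˡ-∑ k xs f))

    *-distribʳ-∑ : ∀ k (xs : List A) f → ∑ xs f * k ≈ ∑ xs (λ a → f a * k)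
    *-distribʳ-∑ k xs f = trans (*-comm _ k) (trans (*-distribˡ-∑ k xs f) (∑-cong xs (λ a → *-comm k (f a))))

    ∑-vanish : ∀ (xs : List A) (f : A → Carrier) → ∑ xs (λ a → 0# * f a) ≈ 0#
    ∑-vanish xs f = trans (sym (*-distribˡ-∑ 0# xs f)) (zeroˡ _)

    ∑-distrib-+ : ∀ (xs : List A) f g → ∑ xs (λ a → f a + g a) ≈ ∑ xs f + ∑ xs g
    ∑-distrib-+ []       f g = sym (+-identityˡ 0#)
    ∑-distrib-+ (x ∷ xs) f g = trans (+-congˡ (∑-distrib-+ xs f g)) (+-interchange _ _ _ _)

  ∑-allFin-suc : ∀ {S} (f : Fin (suc S) → Carrier) →
                 ∑ (allFin (suc S)) f ≈ f zero + ∑ (allFin S) (f ∘ suc)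
  ∑-allFin-suc {S} f = +-congˡ (trans (reflexive (≡.cong (λ xs → ∑ xs f) (≡.sym (ListP.map-tabulate id suc))))
                                      (∑-map suc (allFin S) f))

  ∑-allFin-δ : ∀ {S} (u : Fin S) (f : Fin S → Carrier) →
               ∑ (allFin S) (λ t → 𝟙 (does (u FinP.≟ t)) * f t) ≈ f u
  ∑-allFin-δ {suc S} zero    f = trans (∑-allFin-suc (λ t → 𝟙 (does (zero FinP.≟ t)) * f t))
    (trans (+-cong (*-identityˡ _) (∑-vanish (allFin S) (f ∘ suc))) (+-identityʳ _))
  ∑-allFin-δ {suc S} (suc u) f = trans (∑-allFin-suc (λ t → 𝟙 (does (suc u FinP.≟ t)) * f t))
    (trans (+-cong (zeroˡ _) (∑-allFin-δ u (f ∘ suc))) (+-identityˡ _))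

  ∑-allFin-δ′ : ∀ {S} (u : Fin S) (f : Fin S → Carrier) →
                ∑ (allFin S) (λ t → 𝟙 (does (t FinP.≟ u)) * f t) ≈ f u
  ∑-allFin-δ′ u f = trans (∑-cong (allFin _) (λ t → *-congʳ (reflexive
    (≡.cong 𝟙 (does-≡ (t FinP.≟ u) (map′ ≡.sym ≡.sym (u FinP.≟ t)))))))
    (∑-allFin-δ u f)

  ∑-allE-suc : ∀ {n} (G : E (suc n) → Carrier) →
               ∑ (allE (suc n)) G ≈ ∑ (allE n) (G ∘ (true ∷_)) + ∑ (allE n) (G ∘ (false ∷_))
  ∑-allE-suc {n} G =
    trans (∑-++ (List.map (true ∷_) (allE n)) _ G) (+-cong (∑-map _ (allE n) G) (∑-map _ (allE n) G))

  ∑-allE-δ : ∀ {n} (m : E n) (F : E n → Carrier) → ∑ (allE n) (λ e → 𝟙 (does (e ≟ᴱ m)) * F e) ≈ F m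
  ∑-allE-δ {zero}  []          F = trans (+-congʳ (*-identityˡ _)) (+-identityʳ _)
  ∑-allE-δ {suc n} (true ∷ m)  F = trans (∑-allE-suc (λ e → 𝟙 (does (e ≟ᴱ (true ∷ m))) * F e))
    (trans (+-cong (∑-allE-δ m (F ∘ (true ∷_))) (∑-vanish (allE n) (F ∘ (false ∷_)))) (+-identityʳ _))
  ∑-allE-δ {suc n} (false ∷ m) F = trans (∑-allE-suc (λ e → 𝟙 (does (e ≟ᴱ (false ∷ m))) * F e))
    (trans (+-cong (∑-vanish (allE n) (F ∘ (true ∷_))) (∑-allE-δ m (F ∘ (false ∷_)))) (+-identityˡ _))

  ∑-allX-∏ : ∀ n (s : Fin n → ℕ) (F : (a : Fin n) → Fin (s a) → Carrier) →
             ∑ (allX n s) (λ w → ∏ (λ a → F a (w a))) ≈ ∏ (λ a → ∑ (allFin (s a)) (F a))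
  ∑-allX-∏ zero    s F = +-identityʳ 1#
  ∑-allX-∏ (suc n) s F = begin
    ∑ (allX (suc n) s) (λ w → ∏ (λ a → F a (w a)))
      ≈⟨ ∑-concatMap _ (allFin (s zero)) _ ⟩
    ∑ (allFin (s zero)) (λ v → ∑ (List.map _ (allX n (s ∘ suc))) _)
      ≈⟨ ∑-cong (allFin (s zero)) (λ v → trans (∑-map _ (allX n (s ∘ suc)) _)
           (sym (*-distribˡ-∑ (F zero v) (allX n (s ∘ suc)) (λ w → ∏ (λ a → F (suc a) (w a)))))) ⟩
    ∑ (allFin (s zero)) (λ v → F zero v * ∑ (allX n (s ∘ suc)) (λ w → ∏ (λ a → F (suc a) (w a))))
      ≈⟨ ∑-cong (allFin (s zero)) (λ v → *-congˡ (∑-allX-∏ n (s ∘ suc) (F ∘ suc))) ⟩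
    ∑ (allFin (s zero)) (λ v → F zero v * ∏ (λ a → ∑ (allFin (s (suc a))) (F (suc a))))
      ≈⟨ *-distribʳ-∑ _ (allFin (s zero)) (F zero) ⟨
    ∏ (λ a → ∑ (allFin (s a)) (F a)) ∎

  ∑-allE-∏ : ∀ n (F : Fin n → Bool → Carrier) →
             ∑ (allE n) (λ j → ∏ (λ a → F a (lookup j a))) ≈ ∏ (λ a → F a true + F a false)
  ∑-allE-∏ zero    F = +-identityʳ 1#
  ∑-allE-∏ (suc n) F = begin
    ∑ (allE (suc n)) G                                        ≈⟨ ∑-allE-suc G ⟩
    ∑ (allE n) (G ∘ (true ∷_)) + ∑ (allE n) (G ∘ (false ∷_))  ≈⟨ +-cong (factor true) (factor false) ⟩
    F zero true * rest + F zero false * rest                  ≈⟨ distribʳ rest _ _ ⟨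
    (F zero true + F zero false) * rest                       ∎
    where
    G = λ j → ∏ (λ a → F a (lookup j a))
    rest = ∏ (λ a → F (suc a) true + F (suc a) false)
    factor : ∀ b → ∑ (allE n) (G ∘ (b ∷_)) ≈ F zero b * rest
    factor b = trans (sym (*-distribˡ-∑ (F zero b) (allE n) _)) (*-congˡ (∑-allE-∏ n (F ∘ suc)))

module ℕ∑ = Sums ℕP.+-*-commutativeSemiring

-- Möbius inversion over supersets

zeros : ∀ {n} → E n → ℕ
zeros []          = 0
zeros (true ∷ v)  = zeros v
zeros (false ∷ v) = suc (zeros v)

zeros-anti : ∀ {n} (q e : E n) → q ⊆ e → zeros e ≤ zeros q
zeros-anti []          []          q⊆e = z≤n
zeros-anti (true ∷ q)  (true ∷ e)  q⊆e = zeros-anti q e (q⊆e ∘ suc)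
zeros-anti (true ∷ q)  (false ∷ e) q⊆e = contradiction (q⊆e zero _) λ ()
zeros-anti (false ∷ q) (true ∷ e)  q⊆e = ℕP.m≤n⇒m≤1+n (zeros-anti q e (q⊆e ∘ suc))
zeros-anti (false ∷ q) (false ∷ e) q⊆e = s≤s (zeros-anti q e (q⊆e ∘ suc))

zeros-strict : ∀ {n} (q e : E n) → q ⊆ e → e ≢ q → zeros e < zeros q
zeros-strict []          []          q⊆e e≢q = contradiction ≡.refl e≢q
zeros-strict (true ∷ q)  (true ∷ e)  q⊆e e≢q = zeros-strict q e (q⊆e ∘ suc) (e≢q ∘ ≡.cong (true ∷_))
zeros-strict (true ∷ q)  (false ∷ e) q⊆e e≢q = contradiction (q⊆e zero _) λ ()
zeros-strict (false ∷ q) (true ∷ e)  q⊆e e≢q = s≤s (zeros-anti q e (q⊆e ∘ suc))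
zeros-strict (false ∷ q) (false ∷ e) q⊆e e≢q =
  s≤s (zeros-strict q e (q⊆e ∘ suc) (e≢q ∘ ≡.cong (false ∷_)))

module SupersetInversion {c ℓ} (R : CommutativeRing c ℓ) where
  open CommutativeRing R hiding (zero)
  open Sums commutativeSemiring
  open import Algebra.Properties.Ring ring using (+-cancelʳ)
  open import Algebra.Properties.CommutativeSemigroup *-commutativeSemigroup using (x∙yz≈y∙xz)
  open import Relation.Binary.Reasoning.Setoid setoid

  _⊊ᵇ_ : ∀ {n} → E n → E n → Bool
  q ⊊ᵇ e = does (q ⊆? e) ∧ not (does (e ≟ᴱ q))

  𝟙-⊆?-split : ∀ {n} (q e : E n) → 𝟙 (does (q ⊆? e)) ≈ 𝟙 (does (e ≟ᴱ q)) + 𝟙 (q ⊊ᵇ e)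
  𝟙-⊆?-split q e with e ≟ᴱ q
  ... | yes ≡.refl rewrite dec-true (q ⊆? q) (λ _ t → t) = sym (+-identityʳ 1#)
  ... | no _       = trans (reflexive (≡.cong 𝟙 (≡.sym (BoolP.∧-identityʳ _)))) (sym (+-identityˡ _))

  ⊊ᵇ⇒zeros< : ∀ {n} (q e : E n) → T (q ⊊ᵇ e) → zeros e < zeros q
  ⊊ᵇ⇒zeros< q e q⊊e = zeros-strict q e (from-does (q ⊆? e) (proj₁ parts)) λ e≡q →
    contradiction (≡.trans (≡.sym (dec-true (e ≟ᴱ q) e≡q)) (Equivalence.to BoolP.T-not-≡ (proj₂ parts))) λ ()
    where parts = Equivalence.to BoolP.T-∧ q⊊e

  module _ {n} (V : E n → Bool) where

    ∑⊇ : (E n → Carrier) → E n → Carrier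
    ∑⊇ φ q = ∑ (allE n) (λ e → 𝟙 (V e) * (𝟙 (does (q ⊆? e)) * φ e))

    ∑⊇-split : ∀ φ q → T (V q) →
               ∑⊇ φ q ≈ φ q + ∑ (allE n) (λ e → 𝟙 (V e) * (𝟙 (q ⊊ᵇ e) * φ e))
    ∑⊇-split φ q Vq = begin
      ∑⊇ φ q
        ≈⟨ ∑-cong (allE n) pointwise ⟩
      ∑ (allE n) (λ e → 𝟙 (does (e ≟ᴱ q)) * (𝟙 (V e) * φ e) + 𝟙 (V e) * (𝟙 (q ⊊ᵇ e) * φ e))
        ≈⟨ ∑-distrib-+ (allE n) _ _ ⟩
      ∑ (allE n) (λ e → 𝟙 (does (e ≟ᴱ q)) * (𝟙 (V e) * φ e))
        + ∑ (allE n) (λ e → 𝟙 (V e) * (𝟙 (q ⊊ᵇ e) * φ e))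
        ≈⟨ +-congʳ (trans (∑-allE-δ q (λ e → 𝟙 (V e) * φ e))
                          (trans (*-congʳ (reflexive (≡.cong 𝟙 (Equivalence.to BoolP.T-≡ Vq)))) (*-identityˡ _))) ⟩
      φ q + ∑ (allE n) (λ e → 𝟙 (V e) * (𝟙 (q ⊊ᵇ e) * φ e)) ∎
      where
      pointwise : ∀ e → 𝟙 (V e) * (𝟙 (does (q ⊆? e)) * φ e)
                        ≈ 𝟙 (does (e ≟ᴱ q)) * (𝟙 (V e) * φ e) + 𝟙 (V e) * (𝟙 (q ⊊ᵇ e) * φ e)
      pointwise e = begin
        𝟙 (V e) * (𝟙 (does (q ⊆? e)) * φ e)                       ≈⟨ *-congˡ (*-congʳ (𝟙-⊆?-split q e)) ⟩
        𝟙 (V e) * ((𝟙 (does (e ≟ᴱ q)) + 𝟙 (q ⊊ᵇ e)) * φ e)       ≈⟨ *-congˡ (distribʳ _ _ _) ⟩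
        𝟙 (V e) * (𝟙 (does (e ≟ᴱ q)) * φ e + 𝟙 (q ⊊ᵇ e) * φ e)   ≈⟨ distribˡ _ _ _ ⟩
        𝟙 (V e) * (𝟙 (does (e ≟ᴱ q)) * φ e) + 𝟙 (V e) * (𝟙 (q ⊊ᵇ e) * φ e)
          ≈⟨ +-congʳ (x∙yz≈y∙xz _ _ _) ⟩
        𝟙 (does (e ≟ᴱ q)) * (𝟙 (V e) * φ e) + 𝟙 (V e) * (𝟙 (q ⊊ᵇ e) * φ e) ∎

    superset-inversion : ∀ (φ ψ : E n → Carrier) → (∀ q → T (V q) → ∑⊇ φ q ≈ ∑⊇ ψ q) →
                         ∀ q → T (V q) → φ q ≈ ψ q
    superset-inversion φ ψ ∑⊇φ≈∑⊇ψ q = below (suc (zeros q)) q ℕP.≤-refl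
      where
      -- Induction on a bound for the number of zeros of q, which strict supersets of q lower.
      below : ∀ k q → zeros q < k → T (V q) → φ q ≈ ψ q
      below (suc k) q (s≤s zq≤k) Vq = +-cancelʳ _ (φ q) (ψ q) (begin
        φ q + ∑ (allE n) (λ e → 𝟙 (V e) * (𝟙 (q ⊊ᵇ e) * φ e))  ≈⟨ ∑⊇-split φ q Vq ⟨
        ∑⊇ φ q                                                   ≈⟨ ∑⊇φ≈∑⊇ψ q Vq ⟩
        ∑⊇ ψ q                                                   ≈⟨ ∑⊇-split ψ q Vq ⟩
        ψ q + ∑ (allE n) (λ e → 𝟙 (V e) * (𝟙 (q ⊊ᵇ e) * ψ e))
          ≈⟨ +-congˡ (∑-cong (allE n) (λ e → 𝟙-guard (V e) (q ⊊ᵇ e) λ Ve q⊊e →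
               below k e (ℕP.<-≤-trans (⊊ᵇ⇒zeros< q e q⊊e) zq≤k) Ve)) ⟨
        ψ q + ∑ (allE n) (λ e → 𝟙 (V e) * (𝟙 (q ⊊ᵇ e) * φ e))  ∎)

-- The sets ℙ and [g,h,i,k,l] coordinatewise

big : ℕ → Bool
big S = ⌊ 2 ℕP.<? S ⌋

admissible : (big G H I : Bool) → Bool
admissible big G H I = ((G xor I) ⇒ᵇ H) ∧ (H ⇒ᵇ ((G xor I) ∨ ((G ∧ I) ∧ big)))

bracketᵇ : (big G H I K L : Bool) → Bool
bracketᵇ big G H I K L = (G xor L) ∨ ((((G ∧ L) ∧ big) ∧ not I) ∨ ((H ∨ K) ∧ (((G ∧ I) ∧ L) ∧ big)))

module _ {n} (s : Fin n → ℕ) where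

  lookup-△ : ∀ (g h : E n) a → lookup (g △ h) a ≡ (lookup g a xor lookup h a)
  lookup-△ g h a = VecP.lookup-zipWith _xor_ a g h

  lookup-∩ : ∀ (g h : E n) a → lookup (g ∩ h) a ≡ (lookup g a ∧ lookup h a)
  lookup-∩ g h a = VecP.lookup-zipWith _∧_ a g h

  lookup-∪ : ∀ (g h : E n) a → lookup (g ∪ h) a ≡ (lookup g a ∨ lookup h a)
  lookup-∪ g h a = VecP.lookup-zipWith _∨_ a g h

  lookup-∖ : ∀ (g h : E n) a → lookup (g ∖ h) a ≡ (lookup g a ∧ not (lookup h a))
  lookup-∖ g h a = VecP.lookup-zipWith _ a g h

  lookup-° : ∀ (g : E n) a → lookup (_° {s = s} g) a ≡ (lookup g a ∧ big (s a))
  lookup-° g a = VecP.lookup∘tabulate _ a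

  lookup-ℙ-bound : ∀ (g i : E n) a → lookup ((g △ i) ∪ _° {s = s} (g ∩ i)) a
                   ≡ ((lookup g a xor lookup i a) ∨ ((lookup g a ∧ lookup i a) ∧ big (s a)))
  lookup-ℙ-bound g i a = ≡.trans (lookup-∪ (g △ i) _ a)
    (≡.cong₂ _∨_ (lookup-△ g i a) (≡.trans (lookup-° (g ∩ i) a) (≡.cong (_∧ big (s a)) (lookup-∩ g i a))))

  lookup-bracket : ∀ (g h i k l : E n) a → lookup (bracket s g h i k l) a
                   ≡ bracketᵇ (big (s a)) (lookup g a) (lookup h a) (lookup i a) (lookup k a) (lookup l a)
  lookup-bracket g h i k l a = begin
    lookup (bracket s g h i k l) a
      ≡⟨ lookup-∪ (g △ l) _ a ⟩
    lookup (g △ l) a ∨ lookup ((_° {s = s} (g ∩ l) ∖ i) ∪ ((h ∪ k) ∩ _° {s = s} ((g ∩ i) ∩ l))) a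
      ≡⟨ ≡.cong₂ _∨_ (lookup-△ g l a) (lookup-∪ (_° {s = s} (g ∩ l) ∖ i) _ a) ⟩
    (G xor L) ∨ (lookup (_° {s = s} (g ∩ l) ∖ i) a ∨ lookup ((h ∪ k) ∩ _° {s = s} ((g ∩ i) ∩ l)) a)
      ≡⟨ ≡.cong₂ (λ u v → (G xor L) ∨ (u ∨ v))
                 (lookup-∖ (_° {s = s} (g ∩ l)) i a) (lookup-∩ (h ∪ k) _ a) ⟩
    (G xor L) ∨ ((lookup (_° {s = s} (g ∩ l)) a ∧ not I)
                 ∨ (lookup (h ∪ k) a ∧ lookup (_° {s = s} ((g ∩ i) ∩ l)) a))
      ≡⟨ ≡.cong₂ (λ u v → (G xor L) ∨ ((u ∧ not I) ∨ v)) (lookup-° (g ∩ l) a)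
                 (≡.cong₂ _∧_ (lookup-∪ h k a) (lookup-° ((g ∩ i) ∩ l) a)) ⟩
    (G xor L) ∨ (((lookup (g ∩ l) a ∧ B) ∧ not I) ∨ ((H ∨ K) ∧ (lookup ((g ∩ i) ∩ l) a ∧ B)))
      ≡⟨ ≡.cong₂ (λ u v → (G xor L) ∨ (((u ∧ B) ∧ not I) ∨ ((H ∨ K) ∧ (v ∧ B)))) (lookup-∩ g l a)
                 (≡.trans (lookup-∩ (g ∩ i) l a) (≡.cong (_∧ L) (lookup-∩ g i a))) ⟩
    bracketᵇ B G H I K L ∎
    where
    open ≡.≡-Reasoning
    B = big (s a)
    G = lookup g a ; H = lookup h a ; I = lookup i a ; K = lookup k a ; L = lookup l a

  ℙ⇒admissible : ∀ g h i → ℙ s g h i →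
                 ∀ a → T (admissible (big (s a)) (lookup g a) (lookup h a) (lookup i a))
  ℙ⇒admissible g h i (lower , upper) a = Equivalence.from BoolP.T-∧
    ( ⇒ᵇ-intro _ _ (λ t → lower a (≡.subst T (≡.sym (lookup-△ g i a)) t))
    , ⇒ᵇ-intro _ _ (λ t → ≡.subst T (lookup-ℙ-bound g i a) (upper a t)))

  admissible⇒ℙ : ∀ g h i → (∀ a → T (admissible (big (s a)) (lookup g a) (lookup h a) (lookup i a))) →
                 ℙ s g h i
  admissible⇒ℙ g h i adm =
      (λ a t → ⇒ᵇ-elim _ _ (proj₁ (both a)) (≡.subst T (lookup-△ g i a) t))
    , (λ a t → ≡.subst T (≡.sym (lookup-ℙ-bound g i a)) (⇒ᵇ-elim _ _ (proj₂ (both a)) t))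
    where both = λ a → Equivalence.to BoolP.T-∧ (adm a)

  ℙ-member : ∀ g h i → ℙ s g h i → T (does (ℙ? s g h i))
  ℙ-member g h i ghi = Equivalence.from BoolP.T-≡ (dec-true (ℙ? s g h i) ghi)

ℙ-bracket : ∀ {n} (s : Fin n → ℕ) (g h i k l : E n) → ℙ s g (bracket s g h i k l) l
ℙ-bracket s g h i k l = admissible⇒ℙ s g (bracket s g h i k l) l λ a →
  ≡.subst (λ b → T (admissible (big (s a)) (lookup g a) b (lookup l a))) (≡.sym (lookup-bracket s g h i k l a))
    (bracket-admissible (big (s a)) (lookup g a) (lookup h a) (lookup i a) (lookup k a) (lookup l a))
  where
  bracket-admissible : ∀ B G H I K L → T (admissible B G (bracketᵇ B G H I K L) L)
  bracket-admissible = from-yes (∀-Bool? λ B → ∀-Bool? λ G → ∀-Bool? λ H → ∀-Bool? λ I → ∀-Bool? λ K →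
    ∀-Bool? λ L → T? (admissible B G (bracketᵇ B G H I K L) L))

-- One coordinate

module LocalFactor {c ℓ} (R : CommutativeSemiring c ℓ) where
  open CommutativeSemiring R
  open Sums R using (𝟙)

  -- The factor of B_{g,h,i}(u,v) at a coordinate where g, h, i have entries G, H, I and x ≠ u, u ≠ v,
  -- x ≠ v have truth values dxu, duv, dxv; the two terms are j_a = 1 and j_a = 0 in the sum defining B.
  localB : (G H I dxu duv dxv : Bool) → Carrier
  localB G H I dxu duv dxv = term true + term false
    where
    term : Bool → Carrier
    term b = (𝟙 ((G xor I) ⇒ᵇ b) * 𝟙 (b ⇒ᵇ H)) * ((𝟙 (dxu ≐ G) * 𝟙 (duv ≐ b)) * 𝟙 (dxv ≐ I))

  localB-closed : (A B C M Q R : Bool) → Carrier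
  localB-closed A B C M Q R = ((𝟙 (A ≐ M) * 𝟙 (C ≐ R)) * 𝟙 ((A xor C) ⇒ᵇ Q)) * 𝟙 (Q ⇒ᵇ B)

  localIndicator : (big G H I J K L M Q R : Bool) → Carrier
  localIndicator big G H I J K L M Q R =
    ((𝟙 (I ≐ J) * 𝟙 (M ≐ G)) * 𝟙 (R ≐ L)) * 𝟙 (Q ⇒ᵇ bracketᵇ big G H I K L)

module ℕLocalFactor = LocalFactor ℕP.+-*-commutativeSemiring

module Coordinate where
  open ℕ∑
  open ℕLocalFactor
  open Nat using (_+_; _*_; _∸_)

  ≠ᵇ-irrefl : ∀ {S} (u : Fin S) → u ≠ᵇ u ≡ false
  ≠ᵇ-irrefl u = ≡.cong not (≡.trans (isYes≗does (u FinP.≟ u)) (dec-true (u FinP.≟ u) ≡.refl))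

  ≢⇒≠ᵇ : ∀ {S} {u v : Fin S} → u ≢ v → u ≠ᵇ v ≡ true
  ≢⇒≠ᵇ {u = u} {v} u≢v = ≡.cong not (≡.trans (isYes≗does (u FinP.≟ v)) (dec-false (u FinP.≟ v) u≢v))

  ≠ᵇ-sym : ∀ {S} (u v : Fin S) → u ≠ᵇ v ≡ v ≠ᵇ u
  ≠ᵇ-sym u v = ≡.cong not (≡.trans (isYes≗does (u FinP.≟ v))
    (≡.trans (does-≡ (u FinP.≟ v) (map′ ≡.sym ≡.sym (v FinP.≟ u))) (≡.sym (isYes≗does (v FinP.≟ u)))))

  ∑-const : ∀ S c → ∑ (allFin S) (λ _ → c) ≡ S * c
  ∑-const zero    c = ≡.refl
  ∑-const (suc S) c = ≡.trans (∑-allFin-suc {S} (λ _ → c)) (≡.cong (c +_) (∑-const S c))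

  -- Both sides are shifted by three copies of Φ true true true, the value away from the pᵢ,
  -- so that no subtraction occurs.
  ∑-three-points : ∀ {S} {p₀ p₁ p₂ : Fin S} → p₀ ≢ p₁ → p₀ ≢ p₂ → p₁ ≢ p₂ →
    (Φ : Bool → Bool → Bool → ℕ) →
    ∑ (allFin S) (λ t → Φ (p₀ ≠ᵇ t) (p₁ ≠ᵇ t) (p₂ ≠ᵇ t))
      + (Φ true true true + Φ true true true + Φ true true true)
    ≡ S * Φ true true true + (Φ false true true + Φ true false true + Φ true true false)
  ∑-three-points {S} {p₀} {p₁} {p₂} p₀≢p₁ p₀≢p₂ p₁≢p₂ Φ = begin
    ∑ ts F + (c + c + c)                                      ≡⟨ ≡.cong (∑ ts F +_) (∑-δ₃ c c c) ⟨
    ∑ ts F + ∑ ts (λ t → δ p₀ c t + δ p₁ c t + δ p₂ c t)      ≡⟨ ∑-distrib-+ ts F _ ⟨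
    ∑ ts (λ t → F t + (δ p₀ c t + δ p₁ c t + δ p₂ c t))       ≡⟨ ∑-cong ts pointwise ⟩
    ∑ ts (λ t → c + (δ p₀ A₀ t + δ p₁ A₁ t + δ p₂ A₂ t))      ≡⟨ ∑-distrib-+ ts (λ _ → c) _ ⟩
    ∑ ts (λ _ → c) + ∑ ts (λ t → δ p₀ A₀ t + δ p₁ A₁ t + δ p₂ A₂ t)
      ≡⟨ ≡.cong₂ _+_ (∑-const S c) (∑-δ₃ A₀ A₁ A₂) ⟩
    S * c + (A₀ + A₁ + A₂)                                    ∎
    where
    open ≡.≡-Reasoning
    ts = allFin S
    F = λ t → Φ (p₀ ≠ᵇ t) (p₁ ≠ᵇ t) (p₂ ≠ᵇ t)
    c = Φ true true true
    A₀ = Φ false true true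
    A₁ = Φ true false true
    A₂ = Φ true true false
    δ : Fin S → ℕ → Fin S → ℕ
    δ p a t = 𝟙 (does (p FinP.≟ t)) * a
    ∑-δ₃ : ∀ a₀ a₁ a₂ → ∑ ts (λ t → δ p₀ a₀ t + δ p₁ a₁ t + δ p₂ a₂ t) ≡ a₀ + a₁ + a₂
    ∑-δ₃ a₀ a₁ a₂ = ≡.trans (∑-distrib-+ ts _ (δ p₂ a₂)) (≡.cong₂ _+_
      (≡.trans (∑-distrib-+ ts (δ p₀ a₀) (δ p₁ a₁))
               (≡.cong₂ _+_ (∑-allFin-δ p₀ (λ _ → a₀)) (∑-allFin-δ p₁ (λ _ → a₁))))
      (∑-allFin-δ p₂ (λ _ → a₂)))
    at₀ : ∀ a c → a + (1 * c + 0 + 0) ≡ c + (1 * a + 0 + 0)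
    at₀ = solve-∀
    at₁ : ∀ a c → a + (0 + 1 * c + 0) ≡ c + (0 + 1 * a + 0)
    at₁ = solve-∀
    at₂ : ∀ a c → a + (0 + 0 + 1 * c) ≡ c + (0 + 0 + 1 * a)
    at₂ = solve-∀
    pointwise : ∀ t → F t + (δ p₀ c t + δ p₁ c t + δ p₂ c t)
                      ≡ c + (δ p₀ A₀ t + δ p₁ A₁ t + δ p₂ A₂ t)
    pointwise t with p₀ FinP.≟ t | p₁ FinP.≟ t | p₂ FinP.≟ t
    ... | yes ≡.refl | yes ≡.refl | _          = contradiction ≡.refl p₀≢p₁
    ... | yes ≡.refl | _          | yes ≡.refl = contradiction ≡.refl p₀≢p₂
    ... | _          | yes ≡.refl | yes ≡.refl = contradiction ≡.refl p₁≢p₂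
    ... | yes ≡.refl | no _       | no _       = at₀ A₀ c
    ... | no _       | yes ≡.refl | no _       = at₁ A₁ c
    ... | no _       | no _       | yes ≡.refl = at₂ A₂ c
    ... | no _       | no _       | no _       = ≡.refl

  other : ∀ {N} → Fin (2 + N) → Fin (2 + N)
  other zero    = suc zero
  other (suc _) = zero

  -- For |U_a| = 2 there is no third point and x itself is returned.
  third : ∀ {N} → Fin (2 + N) → Fin (2 + N)
  third {zero}  x             = x
  third {suc N} zero          = suc (suc zero)
  third {suc N} (suc zero)    = suc (suc zero)
  third {suc N} (suc (suc _)) = suc zero

  x≢other : ∀ {N} (x : Fin (2 + N)) → x ≢ other x
  x≢other zero    ()
  x≢other (suc _) ()

  x≢third : ∀ {N} (x : Fin (3 + N)) → x ≢ third x
  x≢third zero          ()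
  x≢third (suc zero)    ()
  x≢third (suc (suc _)) ()

  other≢third : ∀ {N} (x : Fin (3 + N)) → other x ≢ third x
  other≢third zero          ()
  other≢third (suc zero)    ()
  other≢third (suc (suc _)) ()

  points : ∀ {N} → Fin (2 + N) → Vec (Fin (2 + N)) 3
  points x = x ∷ other x ∷ third x ∷ []

  -- Positions in  points x  of points y, z with x ≠ y, y ≠ z, x ≠ z given by M, Q, R.
  posY : Bool → Fin 3
  posY M = if M then suc zero else zero

  posZ : Bool → Bool → Bool → Fin 3
  posZ M Q R = if R then (if Q then (if M then suc (suc zero) else suc zero) else posY M) else zero

  record Realises {S} (x y z : Fin S) (M Q R : Bool) : Set where
    field
      x≠y : x ≠ᵇ y ≡ M
      y≠z : y ≠ᵇ z ≡ Q
      x≠z : x ≠ᵇ z ≡ R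

  points-realise : ∀ {N} (x : Fin (2 + N)) M Q R → T (admissible (big (2 + N)) M Q R) →
                   Realises x (lookup (points x) (posY M)) (lookup (points x) (posZ M Q R)) M Q R
  points-realise x false false false _ =
    record { x≠y = ≠ᵇ-irrefl x ; y≠z = ≠ᵇ-irrefl x ; x≠z = ≠ᵇ-irrefl x }
  points-realise x true  true  false _ =
    record { x≠y = ≢⇒≠ᵇ (x≢other x) ; y≠z = ≡.trans (≠ᵇ-sym _ x) (≢⇒≠ᵇ (x≢other x))
           ; x≠z = ≠ᵇ-irrefl x }
  points-realise x false true  true  _ =
    record { x≠y = ≠ᵇ-irrefl x ; y≠z = ≢⇒≠ᵇ (x≢other x) ; x≠z = ≢⇒≠ᵇ (x≢other x) }
  points-realise x true  false true  _ =
    record { x≠y = ≢⇒≠ᵇ (x≢other x) ; y≠z = ≠ᵇ-irrefl _ ; x≠z = ≢⇒≠ᵇ (x≢other x) }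
  points-realise {suc N} x true true true _ =
    record { x≠y = ≢⇒≠ᵇ (x≢other x) ; y≠z = ≢⇒≠ᵇ (other≢third x) ; x≠z = ≢⇒≠ᵇ (x≢third x) }
  points-realise {zero}  x true  true  true  ()
  points-realise         x false false true  ()
  points-realise         x true  false false ()
  points-realise         x false true  false ()

  localBB : ∀ {S} (x y z : Fin S) (G H I J K L : Bool) → ℕ
  localBB x y z G H I J K L =
    ∑ (allFin _) (λ t → localB G H I (x ≠ᵇ y) (y ≠ᵇ t) (x ≠ᵇ t)
                        * localB J K L (x ≠ᵇ t) (t ≠ᵇ z) (x ≠ᵇ z))

  localK : ℕ → Bool → ℕ
  localK S b = if b then S ∸ 1 else 1

  localCoefficient : ℕ → (G H I J K L M Q R : Bool) → ℕ
  localCoefficient S G H I J K L M Q R = localIndicator (big S) G H I J K L M Q R * localK S ((H ∧ I) ∧ K)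

  localBB-two : ∀ (x : Fin 2) G H I J K L M Q R →
    T (admissible (big 2) G H I) → T (admissible (big 2) J K L) → T (admissible (big 2) M Q R) →
    localBB x (lookup (points {0} x) (posY M)) (lookup (points {0} x) (posZ M Q R)) G H I J K L
    ≡ localCoefficient 2 G H I J K L M Q R
  localBB-two = from-yes (FinP.all? λ x → ∀-Bool? λ G → ∀-Bool? λ H → ∀-Bool? λ I → ∀-Bool? λ J →
    ∀-Bool? λ K → ∀-Bool? λ L → ∀-Bool? λ M → ∀-Bool? λ Q → ∀-Bool? λ R →
    T? (admissible (big 2) G H I) →-dec T? (admissible (big 2) J K L) →-dec T? (admissible (big 2) M Q R) →-dec
    (localBB x (lookup (points {0} x) (posY M)) (lookup (points {0} x) (posZ M Q R)) G H I J K L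
       Nat.≟ localCoefficient 2 G H I J K L M Q R))

  -- The summand of localBB at a point t, in terms of x ≠ t, other x ≠ t, third x ≠ t.
  summand : (G H I J K L M Q R : Bool) → Bool → Bool → Bool → ℕ
  summand G H I J K L M Q R e₀ e₁ e₂ =
    localB G H I M (lookup (e₀ ∷ e₁ ∷ e₂ ∷ []) (posY M)) e₀
    * localB J K L e₀ (lookup (e₀ ∷ e₁ ∷ e₂ ∷ []) (posZ M Q R)) R

  summand-values : ∀ G H I J K L M Q R →
    T (admissible true G H I) → T (admissible true J K L) → T (admissible true M Q R) →
    let Φ = summand G H I J K L M Q R ; b = (H ∧ I) ∧ K ; χ = localIndicator true G H I J K L M Q R in
    (Φ false true true + Φ true false true + Φ true true false ≡ χ * (if b then 2 else 1))
    × (Φ true true true ≡ χ * 𝟙 b)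
  summand-values = from-yes (∀-Bool? λ G → ∀-Bool? λ H → ∀-Bool? λ I → ∀-Bool? λ J → ∀-Bool? λ K →
    ∀-Bool? λ L → ∀-Bool? λ M → ∀-Bool? λ Q → ∀-Bool? λ R →
    let Φ = summand G H I J K L M Q R ; b = (H ∧ I) ∧ K ; χ = localIndicator true G H I J K L M Q R in
    T? (admissible true G H I) →-dec T? (admissible true J K L) →-dec T? (admissible true M Q R) →-dec
    ((Φ false true true + Φ true false true + Φ true true false Nat.≟ χ * (if b then 2 else 1))
     ×-dec (Φ true true true Nat.≟ χ * 𝟙 b)))

  localBB-three : ∀ {N} (x : Fin (3 + N)) G H I J K L M Q R →
    T (admissible true G H I) → T (admissible true J K L) → T (admissible true M Q R) →
    localBB x (lookup (points x) (posY M)) (lookup (points x) (posZ M Q R)) G H I J K L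
    ≡ localCoefficient (3 + N) G H I J K L M Q R
  localBB-three {N} x G H I J K L M Q R ghi jkl mqr = begin
    localBB x y z G H I J K L
      ≡⟨ ∑-cong (allFin (3 + N)) by-points ⟩
    ∑ (allFin (3 + N)) (λ t → Φ (x ≠ᵇ t) (other x ≠ᵇ t) (third x ≠ᵇ t))
      ≡⟨ cancel-three (∑-three-points (x≢other x) (x≢third x) (other≢third x) Φ) ⟩
    N * Φ true true true + (Φ false true true + Φ true false true + Φ true true false)
      ≡⟨ ≡.cong₂ (λ c A → N * c + A) (proj₂ values) (proj₁ values) ⟩
    N * (χ * 𝟙 b) + χ * (if b then 2 else 1)
      ≡⟨ scale b ⟩
    localCoefficient (3 + N) G H I J K L M Q R ∎
    where
    open ≡.≡-Reasoning
    y = lookup (points x) (posY M)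
    z = lookup (points x) (posZ M Q R)
    Φ = summand G H I J K L M Q R
    χ = localIndicator true G H I J K L M Q R
    b = (H ∧ I) ∧ K
    values = summand-values G H I J K L M Q R ghi jkl mqr
    open Realises (points-realise x M Q R mqr)
    by-points : ∀ t → localB G H I (x ≠ᵇ y) (y ≠ᵇ t) (x ≠ᵇ t) * localB J K L (x ≠ᵇ t) (t ≠ᵇ z) (x ≠ᵇ z)
                      ≡ Φ (x ≠ᵇ t) (other x ≠ᵇ t) (third x ≠ᵇ t)
    by-points t = ≡.cong₂ _*_
      (≡.cong₂ (λ d e → localB G H I d e (x ≠ᵇ t)) x≠y (≡.sym (VecP.lookup-map (posY M) (_≠ᵇ t) (points x))))
      (≡.cong₂ (localB J K L (x ≠ᵇ t))
               (≡.trans (≠ᵇ-sym t z) (≡.sym (VecP.lookup-map (posZ M Q R) (_≠ᵇ t) (points x)))) x≠z)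
    cancel-three : ∀ {ν c A} → ν + (c + c + c) ≡ (3 + N) * c + A → ν ≡ N * c + A
    cancel-three {ν} {c} {A} eq = ℕP.+-cancelʳ-≡ (c + c + c) ν (N * c + A) (≡.trans eq (regroup N c A))
      where
      regroup : ∀ N c A → (3 + N) * c + A ≡ N * c + A + (c + c + c)
      regroup = solve-∀
    scale : ∀ b → N * (χ * 𝟙 b) + χ * (if b then 2 else 1) ≡ χ * localK (3 + N) b
    scale true  = lemma N χ
      where
      lemma : ∀ N χ → N * (χ * 1) + χ * 2 ≡ χ * (2 + N)
      lemma = solve-∀
    scale false = lemma N χ
      where
      lemma : ∀ N χ → N * (χ * 0) + χ * 1 ≡ χ * 1
      lemma = solve-∀

  pointsOf : ∀ {S} → 2 ≤ S → Fin S → Vec (Fin S) 3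
  pointsOf (s≤s (s≤s z≤n)) = points

  pointsOf-realise : ∀ {S} (p : 2 ≤ S) (x : Fin S) M Q R → T (admissible (big S) M Q R) →
                     Realises x (lookup (pointsOf p x) (posY M)) (lookup (pointsOf p x) (posZ M Q R)) M Q R
  pointsOf-realise (s≤s (s≤s z≤n)) = points-realise

  localBB-at-points : ∀ {S} (p : 2 ≤ S) (x : Fin S) G H I J K L M Q R →
    T (admissible (big S) G H I) → T (admissible (big S) J K L) → T (admissible (big S) M Q R) →
    localBB x (lookup (pointsOf p x) (posY M)) (lookup (pointsOf p x) (posZ M Q R)) G H I J K L
    ≡ localCoefficient S G H I J K L M Q R
  localBB-at-points {suc (suc zero)}    (s≤s (s≤s z≤n)) = localBB-two
  localBB-at-points {suc (suc (suc N))} (s≤s (s≤s z≤n)) = localBB-three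

  localB-pattern : ∀ A B C M Q R → localB A B C M Q R ≡ localB-closed A B C M Q R
  localB-pattern = from-yes (∀-Bool? λ A → ∀-Bool? λ B → ∀-Bool? λ C → ∀-Bool? λ M → ∀-Bool? λ Q →
    ∀-Bool? λ R → localB A B C M Q R Nat.≟ localB-closed A B C M Q R)

-- Matrix entries

module Entries {c ℓ} (𝔽 : Field c ℓ) (n : ℕ) (s : Fin n → ℕ) (x : X n s) where
  open Field 𝔽 hiding (zero)
  open Setup 𝔽 n s x hiding (_⊕_)
  open Sums commutativeSemiring
  open LocalFactor commutativeSemiring
  open SupersetInversion commutativeRing using (∑⊇)
  open Coordinate using (localBB; localK; localCoefficient)
  open import Algebra.Properties.CommutativeSemigroup *-commutativeSemigroup using (x∙yz≈y∙xz)
  open import Algebra.Solver.CommutativeMonoid *-commutativeMonoid using (solve; _⊜_; _⊕_)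
  open import Relation.Binary.Reasoning.Setoid setoid

  ι-+ : ∀ m k → ι (m Nat.+ k) ≈ ι m + ι k
  ι-+ zero    k = sym (+-identityˡ _)
  ι-+ (suc m) k = trans (+-congˡ (ι-+ m k)) (sym (+-assoc _ _ _))

  ι-* : ∀ m k → ι (m Nat.* k) ≈ ι m * ι k
  ι-* zero    k = sym (zeroˡ _)
  ι-* (suc m) k = begin
    ι (k Nat.+ m Nat.* k)  ≈⟨ ι-+ k (m Nat.* k) ⟩
    ι k + ι (m Nat.* k)    ≈⟨ +-cong (sym (*-identityˡ _)) (ι-* m k) ⟩
    1# * ι k + ι m * ι k   ≈⟨ distribʳ _ _ _ ⟨
    (1# + ι m) * ι k       ∎

  ι-𝟙 : ∀ b → ι (ℕ∑.𝟙 b) ≈ 𝟙 b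
  ι-𝟙 true  = +-identityʳ 1#
  ι-𝟙 false = refl

  ι-𝟙*𝟙 : ∀ b b′ → ι (ℕ∑.𝟙 b Nat.* ℕ∑.𝟙 b′) ≈ 𝟙 b * 𝟙 b′
  ι-𝟙*𝟙 b b′ = trans (ι-* (ℕ∑.𝟙 b) (ℕ∑.𝟙 b′)) (*-cong (ι-𝟙 b) (ι-𝟙 b′))

  ι-𝟙⁴ : ∀ b₁ b₂ b₃ b₄ →
         ι (((ℕ∑.𝟙 b₁ Nat.* ℕ∑.𝟙 b₂) Nat.* ℕ∑.𝟙 b₃) Nat.* ℕ∑.𝟙 b₄)
         ≈ ((𝟙 b₁ * 𝟙 b₂) * 𝟙 b₃) * 𝟙 b₄
  ι-𝟙⁴ b₁ b₂ b₃ b₄ = trans (ι-* ((ℕ∑.𝟙 b₁ Nat.* ℕ∑.𝟙 b₂) Nat.* ℕ∑.𝟙 b₃) (ℕ∑.𝟙 b₄))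
    (*-cong (trans (ι-* (ℕ∑.𝟙 b₁ Nat.* ℕ∑.𝟙 b₂) (ℕ∑.𝟙 b₃))
                   (*-cong (ι-𝟙*𝟙 b₁ b₂) (ι-𝟙 b₃)))
            (ι-𝟙 b₄))

  ι-∑ : ∀ {A : Set} (xs : List A) f → ι (ℕ∑.∑ xs f) ≈ ∑ xs (ι ∘ f)
  ι-∑ []       f = refl
  ι-∑ (a ∷ xs) f = trans (ι-+ (f a) _) (+-congˡ (ι-∑ xs f))

  ι-∏ : ∀ {m} (f : Fin m → ℕ) → ι (ℕ∑.∏ f) ≈ ∏ (ι ∘ f)
  ι-∏ {zero}  f = ι-𝟙 true
  ι-∏ {suc m} f = trans (ι-* (f zero) _) (*-congˡ (ι-∏ (f ∘ suc)))

  ι-kk : ∀ g → ι (kk s g) ≈ ∏ (λ a → ι (localK (s a) (lookup g a)))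
  ι-kk g = trans (reflexive (≡.cong ι (foldr-map-allFin Nat._*_ 1 (λ a → localK (s a) (lookup g a)))))
                 (ι-∏ (λ a → localK (s a) (lookup g a)))

  ι-localB : ∀ G H I d e f → ι (ℕLocalFactor.localB G H I d e f) ≈ localB G H I d e f
  ι-localB G H I d e f = trans (ι-+ (termℕ true) (termℕ false)) (+-cong (ι-term true) (ι-term false))
    where
    termℕ : Bool → ℕ
    termℕ b = (ℕ∑.𝟙 ((G xor I) ⇒ᵇ b) Nat.* ℕ∑.𝟙 (b ⇒ᵇ H))
              Nat.* ((ℕ∑.𝟙 (d ≐ G) Nat.* ℕ∑.𝟙 (e ≐ b)) Nat.* ℕ∑.𝟙 (f ≐ I))
    ι-term : ∀ b → ι (termℕ b)
                   ≈ (𝟙 ((G xor I) ⇒ᵇ b) * 𝟙 (b ⇒ᵇ H)) * ((𝟙 (d ≐ G) * 𝟙 (e ≐ b)) * 𝟙 (f ≐ I))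
    ι-term b = trans (ι-* (ℕ∑.𝟙 ((G xor I) ⇒ᵇ b) Nat.* ℕ∑.𝟙 (b ⇒ᵇ H)) _) (*-cong (ι-𝟙*𝟙 _ _)
      (trans (ι-* (ℕ∑.𝟙 (d ≐ G) Nat.* ℕ∑.𝟙 (e ≐ b)) (ℕ∑.𝟙 (f ≐ I)))
             (*-cong (ι-𝟙*𝟙 _ _) (ι-𝟙 _))))

  ι-localBB : ∀ {S} (x₀ y z : Fin S) G H I J K L → ι (localBB x₀ y z G H I J K L)
    ≈ ∑ (allFin S) (λ t → localB G H I (x₀ ≠ᵇ y) (y ≠ᵇ t) (x₀ ≠ᵇ t)
                          * localB J K L (x₀ ≠ᵇ t) (t ≠ᵇ z) (x₀ ≠ᵇ z))
  ι-localBB {S} x₀ y z G H I J K L = trans (ι-∑ (allFin S) _) (∑-cong (allFin S) λ t →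
    trans (ι-* (ℕLocalFactor.localB G H I (x₀ ≠ᵇ y) (y ≠ᵇ t) (x₀ ≠ᵇ t))
               (ℕLocalFactor.localB J K L (x₀ ≠ᵇ t) (t ≠ᵇ z) (x₀ ≠ᵇ z)))
          (*-cong (ι-localB _ _ _ _ _ _) (ι-localB _ _ _ _ _ _)))

  Local : Set c
  Local = (a : Fin n) → Fin (s a) → Fin (s a) → Carrier

  infix 4 _≈⨂_
  _≈⨂_ : Mat → Local → Set ℓ
  M ≈⨂ m = ∀ y z → M y z ≈ ∏ (λ a → m a (y a) (z a))

  ⨂-cong : ∀ {M m m′} → M ≈⨂ m → (∀ a u v → m a u v ≈ m′ a u v) → M ≈⨂ m′
  ⨂-cong M≈m m≈m′ y z = trans (M≈m y z) (∏-cong (λ a → m≈m′ a (y a) (z a)))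

  ⊗-⨂ : ∀ {M N} m m′ → M ≈⨂ m → N ≈⨂ m′ →
        M ⊗ N ≈⨂ (λ a u v → ∑ (allFin (s a)) (λ t → m a u t * m′ a t v))
  ⊗-⨂ {M} {N} m m′ M≈m N≈m′ y z = begin
    ∑ (allX n s) (λ w → M y w * N w z)
      ≈⟨ ∑-cong (allX n s) (λ w → trans (*-cong (M≈m y w) (N≈m′ w z)) (sym (∏-distrib-* {n} _ _))) ⟩
    ∑ (allX n s) (λ w → ∏ (λ a → m a (y a) (w a) * m′ a (w a) (z a)))
      ≈⟨ ∑-allX-∏ n s (λ a t → m a (y a) t * m′ a t (z a)) ⟩
    ∏ (λ a → ∑ (allFin (s a)) (λ t → m a (y a) t * m′ a t (z a))) ∎

  E*ₗ Aₗ : E n → Local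
  E*ₗ g a u v = 𝟙 (does (u FinP.≟ v)) * 𝟙 ((x a ≠ᵇ u) ≐ lookup g a)
  Aₗ j a u v = 𝟙 ((u ≠ᵇ v) ≐ lookup j a)

  Bₗ : E n → E n → E n → Local
  Bₗ g h i a u v = localB (lookup g a) (lookup h a) (lookup i a) (x a ≠ᵇ u) (u ≠ᵇ v) (x a ≠ᵇ v)

  E*-⨂ : ∀ g → E* g ≈⨂ E*ₗ g
  E*-⨂ g y v = begin
    𝟙 (eqX y v ∧ R g x y)
      ≈⟨ 𝟙-∧ (eqX y v) (R g x y) ⟩
    𝟙 (eqX y v) * 𝟙 (R g x y)
      ≈⟨ *-cong (𝟙-and-allFin (λ a → ⌊ y a FinP.≟ v a ⌋))
                (𝟙-and-allFin (λ a → (x a ≠ᵇ y a) ≐ lookup g a)) ⟩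
    ∏ (λ a → 𝟙 ⌊ y a FinP.≟ v a ⌋) * ∏ (λ a → 𝟙 ((x a ≠ᵇ y a) ≐ lookup g a))
      ≈⟨ ∏-distrib-* {n} _ _ ⟨
    ∏ (λ a → 𝟙 ⌊ y a FinP.≟ v a ⌋ * 𝟙 ((x a ≠ᵇ y a) ≐ lookup g a))
      ≈⟨ ∏-cong (λ a → *-congʳ (reflexive (≡.cong 𝟙 (isYes≗does (y a FinP.≟ v a))))) ⟩
    ∏ (λ a → E*ₗ g a (y a) (v a)) ∎

  A-⨂ : ∀ j → A j ≈⨂ Aₗ j
  A-⨂ j y z = 𝟙-and-allFin (λ a → (y a ≠ᵇ z a) ≐ lookup j a)

  E*AE*-⨂ : ∀ g j i → (E* g ⊗ A j) ⊗ E* i ≈⨂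
    (λ a u v → (𝟙 ((x a ≠ᵇ u) ≐ lookup g a) * 𝟙 ((u ≠ᵇ v) ≐ lookup j a)) * 𝟙 ((x a ≠ᵇ v) ≐ lookup i a))
  E*AE*-⨂ g j i = ⨂-cong (⊗-⨂ E*A (E*ₗ i) E*A-⨂ (E*-⨂ i)) collapse-right
    where
    E*A : Local
    E*A a u w = 𝟙 ((x a ≠ᵇ u) ≐ lookup g a) * 𝟙 ((u ≠ᵇ w) ≐ lookup j a)
    collapse-middle : ∀ a u w → ∑ (allFin (s a)) (λ t → E*ₗ g a u t * Aₗ j a t w) ≈ E*A a u w
    collapse-middle a u w = trans (∑-cong (allFin (s a)) (λ t → *-assoc _ _ _)) (∑-allFin-δ u _)
    E*A-⨂ : E* g ⊗ A j ≈⨂ E*A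
    E*A-⨂ = ⨂-cong (⊗-⨂ (E*ₗ g) (Aₗ j) (E*-⨂ g) (A-⨂ j)) collapse-middle
    collapse-right : ∀ a u v → ∑ (allFin (s a)) (λ t → E*A a u t * E*ₗ i a t v)
                               ≈ E*A a u v * 𝟙 ((x a ≠ᵇ v) ≐ lookup i a)
    collapse-right a u v = trans (∑-cong (allFin (s a)) (λ t → x∙yz≈y∙xz _ _ _)) (∑-allFin-δ′ v _)

  ΣM-entry : ∀ {A : Set} (xs : List A) (F : A → Mat) y z → ΣM xs F y z ≈ ∑ xs (λ a → F a y z)
  ΣM-entry []       F y z = refl
  ΣM-entry (a ∷ xs) F y z = +-congˡ (ΣM-entry xs F y z)

  B-⨂ : ∀ g h i → B g h i ≈⨂ Bₗ g h i
  B-⨂ g h i y z = begin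
    B g h i y z
      ≈⟨ ΣM-entry (filter P? (allE n)) _ y z ⟩
    ∑ (filter P? (allE n)) (λ j → ((E* g ⊗ A j) ⊗ E* i) y z)
      ≈⟨ ∑-filter P? (allE n) _ ⟩
    ∑ (allE n) (λ j → 𝟙 (does (P? j)) * ((E* g ⊗ A j) ⊗ E* i) y z)
      ≈⟨ ∑-cong (allE n) (λ j → trans (*-cong (range j) (E*AE*-⨂ g j i y z)) (sym (∏-distrib-* {n} _ _))) ⟩
    ∑ (allE n) (λ j → ∏ (λ a → term a (lookup j a)))
      ≈⟨ ∑-allE-∏ n term ⟩
    ∏ (λ a → Bₗ g h i a (y a) (z a)) ∎
    where
    P? = λ j → ((g △ i) ⊆? j) ×-dec (j ⊆? h)
    term : Fin n → Bool → Carrier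
    term a J = (𝟙 ((lookup g a xor lookup i a) ⇒ᵇ J) * 𝟙 (J ⇒ᵇ lookup h a))
             * ((𝟙 ((x a ≠ᵇ y a) ≐ lookup g a) * 𝟙 ((y a ≠ᵇ z a) ≐ J)) * 𝟙 ((x a ≠ᵇ z a) ≐ lookup i a))
    range : ∀ j → 𝟙 (does (P? j))
                  ≈ ∏ (λ a → 𝟙 ((lookup g a xor lookup i a) ⇒ᵇ lookup j a) * 𝟙 (lookup j a ⇒ᵇ lookup h a))
    range j = begin
      𝟙 (does ((g △ i) ⊆? j) ∧ does (j ⊆? h))
        ≈⟨ 𝟙-∧ (does ((g △ i) ⊆? j)) _ ⟩
      𝟙 (does ((g △ i) ⊆? j)) * 𝟙 (does (j ⊆? h))
        ≈⟨ *-cong (𝟙-⊆? (g △ i) j) (𝟙-⊆? j h) ⟩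
      ∏ (λ a → 𝟙 (lookup (g △ i) a ⇒ᵇ lookup j a)) * ∏ (λ a → 𝟙 (lookup j a ⇒ᵇ lookup h a))
        ≈⟨ ∏-distrib-* {n} _ _ ⟨
      ∏ (λ a → 𝟙 (lookup (g △ i) a ⇒ᵇ lookup j a) * 𝟙 (lookup j a ⇒ᵇ lookup h a))
        ≈⟨ ∏-cong (λ a → *-congʳ (reflexive (≡.cong (λ b → 𝟙 (b ⇒ᵇ lookup j a)) (lookup-△ s g i a)))) ⟩
      ∏ (λ a → 𝟙 ((lookup g a xor lookup i a) ⇒ᵇ lookup j a) * 𝟙 (lookup j a ⇒ᵇ lookup h a)) ∎

  ∑³ : (E n → E n → E n → Carrier) → Carrier
  ∑³ φ = ∑ (allE n) (λ d → ∑ (allE n) (λ e → ∑ (allE n) (λ f → φ d e f)))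

  ∑³-cong : ∀ {φ ψ} → (∀ d e f → φ d e f ≈ ψ d e f) → ∑³ φ ≈ ∑³ ψ
  ∑³-cong φ≈ψ = ∑-cong (allE n) (λ d → ∑-cong (allE n) (λ e → ∑-cong (allE n) (φ≈ψ d e)))

  ΣM-ℙlist : ∀ (F : E n × E n × E n → Mat) y z → ΣM ℙlist F y z ≈ ∑³ (λ d e f → 𝟙 (does (ℙ? s d e f)) * F (d , e , f) y z)
  ΣM-ℙlist F y z = begin
    ΣM ℙlist F y z
      ≈⟨ ΣM-entry ℙlist F y z ⟩
    ∑ ℙlist (λ p → F p y z)
      ≈⟨ ∑-filter ℙ?′ triples _ ⟩
    ∑ triples (λ p → 𝟙 (does (ℙ?′ p)) * F p y z)
      ≈⟨ ∑-concatMap _ (allE n) _ ⟩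
    ∑ (allE n) (λ d → ∑ (triplesWith d) (λ p → 𝟙 (does (ℙ?′ p)) * F p y z))
      ≈⟨ ∑-cong (allE n) (λ d → trans (∑-concatMap _ (allE n) _) (∑-cong (allE n) (λ e → ∑-map _ (allE n) _))) ⟩
    ∑³ (λ d e f → 𝟙 (does (ℙ? s d e f)) * F (d , e , f) y z) ∎
    where
    triplesWith = λ d → concatMap (λ e → List.map (λ f → (d , e , f)) (allE n)) (allE n)
    triples = concatMap triplesWith (allE n)
    ℙ?′ : (p : E n × E n × E n) → Dec _
    ℙ?′ (d , e , f) = ℙ? s d e f

  δ-does : ∀ u v → δ u v ≈ 𝟙 (does (u ≟ᴱ v))
  δ-does u v = reflexive (≡.cong 𝟙 (isYes≗does (u ≟ᴱ v)))

  witnessValue : (g h i j k l m q r : E n) → Carrier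
  witnessValue g h i j k l m q r =
    (((𝟙 (does (i ≟ᴱ j)) * 𝟙 (does (m ≟ᴱ g))) * 𝟙 (does (r ≟ᴱ l))) * 𝟙 (does (q ⊆? bracket s g h i k l)))
    * ι (kk s ((h ∩ i) ∩ k))

  ℙᵇ : E n → E n → E n → Bool
  ℙᵇ m r e = does (ℙ? s m e r)

  claimed : (g h i j k l m r : E n) → E n → Carrier
  claimed g h i j k l m r e = (((δ i j * δ m g) * δ e (bracket s g h i k l)) * δ r l) * ι (kk s ((h ∩ i) ∩ k))

  ∑⊇-claimed : ∀ g h i j k l m q r →
    ∑⊇ (ℙᵇ m r) (claimed g h i j k l m r) q ≈ witnessValue g h i j k l m q r
  ∑⊇-claimed g h i j k l m q r = begin
    ∑ (allE n) (λ e → 𝟙 (V e) * (𝟙 (does (q ⊆? e)) * ((((δ i j * δ m g) * δ e br) * δ r l) * K)))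
      ≈⟨ ∑-cong (allE n) (λ e → trans (*-congˡ (*-congˡ (*-congʳ
           (*-cong (*-cong (*-cong (δ-does i j) (δ-does m g)) (δ-does e br)) (δ-does r l)))))
           (to-front _ _ _ _ _ _ _)) ⟩
    ∑ (allE n) (λ e → 𝟙 (does (e ≟ᴱ br)) * (𝟙 (V e) * (𝟙 (does (q ⊆? e)) * δs)))
      ≈⟨ ∑-allE-δ br _ ⟩
    𝟙 (V br) * (𝟙 (does (q ⊆? br)) * δs)
      ≈⟨ trans (*-congˡ (regroup _ _ _ _ _)) (sym (*-assoc _ _ _)) ⟩
    (𝟙 (V br) * (𝟙mg * 𝟙rl)) * (𝟙ij * (𝟙 (does (q ⊆? br)) * K))
      ≈⟨ *-congʳ (𝟙-absorb (V br) _ _ bracket-in-ℙ) ⟩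
    (𝟙mg * 𝟙rl) * (𝟙ij * (𝟙 (does (q ⊆? br)) * K))
      ≈⟨ reorder _ _ _ _ _ ⟩
    (((𝟙ij * 𝟙mg) * 𝟙rl) * 𝟙 (does (q ⊆? br))) * K ∎
    where
    br = bracket s g h i k l
    K = ι (kk s ((h ∩ i) ∩ k))
    V = ℙᵇ m r
    𝟙ij = 𝟙 (does (i ≟ᴱ j)) ; 𝟙mg = 𝟙 (does (m ≟ᴱ g)) ; 𝟙rl = 𝟙 (does (r ≟ᴱ l))
    δs = ((𝟙ij * 𝟙mg) * 𝟙rl) * K
    to-front : ∀ p a b c d e k → p * (a * ((((b * c) * d) * e) * k)) ≈ d * (p * (a * (((b * c) * e) * k)))
    to-front = solve 7 (λ p a b c d e k → p ⊕ (a ⊕ ((((b ⊕ c) ⊕ d) ⊕ e) ⊕ k))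
                                          ⊜ d ⊕ (p ⊕ (a ⊕ (((b ⊕ c) ⊕ e) ⊕ k)))) refl
    regroup : ∀ a b c d k → a * (((b * c) * d) * k) ≈ (c * d) * (b * (a * k))
    regroup = solve 5 (λ a b c d k → a ⊕ (((b ⊕ c) ⊕ d) ⊕ k) ⊜ (c ⊕ d) ⊕ (b ⊕ (a ⊕ k))) refl
    reorder : ∀ c d b a k → (c * d) * (b * (a * k)) ≈ (((b * c) * d) * a) * k
    reorder = solve 5 (λ c d b a k → (c ⊕ d) ⊕ (b ⊕ (a ⊕ k)) ⊜ (((b ⊕ c) ⊕ d) ⊕ a) ⊕ k) refl
    bracket-in-ℙ : T (does (m ≟ᴱ g)) → T (does (r ≟ᴱ l)) → T (V br)
    bracket-in-ℙ m≡g r≡l with from-does (m ≟ᴱ g) m≡g | from-does (r ≟ᴱ l) r≡l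
    ... | ≡.refl | ≡.refl = ℙ-member s m br r (ℙ-bracket s m h i k r)

  -- Evaluation at the entry (witnessY m, witnessZ m q r), where x ≠ y, y ≠ z, x ≠ z hold exactly on m, q, r.
  module AtWitness (s2 : ∀ a → 2 ≤ s a) where
    open Coordinate using (pointsOf; posY; posZ; pointsOf-realise; localBB-at-points; localB-pattern; Realises)

    witnessY : E n → X n s
    witnessY m a = lookup (pointsOf (s2 a) (x a)) (posY (lookup m a))

    witnessZ : E n → E n → E n → X n s
    witnessZ m q r a = lookup (pointsOf (s2 a) (x a)) (posZ (lookup m a) (lookup q a) (lookup r a))

    realises : ∀ m q r → ℙ s m q r → ∀ a →
               Realises (x a) (witnessY m a) (witnessZ m q r a) (lookup m a) (lookup q a) (lookup r a)
    realises m q r mqr a = pointsOf-realise (s2 a) (x a) _ _ _ (ℙ⇒admissible s m q r mqr a)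

    B-at-witness : ∀ m q r → ℙ s m q r → ∀ d e f → B d e f (witnessY m) (witnessZ m q r)
                   ≈ ((𝟙 (does (d ≟ᴱ m)) * 𝟙 (does (f ≟ᴱ r))) * 𝟙 (does ((d △ f) ⊆? q))) * 𝟙 (does (q ⊆? e))
    B-at-witness m q r mqr d e f = begin
      B d e f y z
        ≈⟨ B-⨂ d e f y z ⟩
      ∏ (λ a → Bₗ d e f a (y a) (z a))
        ≈⟨ ∏-cong local ⟩
      ∏ (λ a → localB-closed (D a) (Ee a) (F a) (M a) (Q a) (Rr a))
        ≈⟨ ∏-distrib-*₄ {n} _ _ _ _ ⟩
      ((∏ (λ a → 𝟙 (D a ≐ M a)) * ∏ (λ a → 𝟙 (F a ≐ Rr a))) * ∏ (λ a → 𝟙 ((D a xor F a) ⇒ᵇ Q a)))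
        * ∏ (λ a → 𝟙 (Q a ⇒ᵇ Ee a))
        ≈⟨ *-cong (*-cong (*-cong (sym (𝟙-≟ᴱ d m)) (sym (𝟙-≟ᴱ f r))) (sym (trans (𝟙-⊆? (d △ f) q)
                    (∏-cong (λ a → reflexive (≡.cong (λ b → 𝟙 (b ⇒ᵇ Q a)) (lookup-△ s d f a)))))))
                  (sym (𝟙-⊆? q e)) ⟩
      ((𝟙 (does (d ≟ᴱ m)) * 𝟙 (does (f ≟ᴱ r))) * 𝟙 (does ((d △ f) ⊆? q))) * 𝟙 (does (q ⊆? e)) ∎
      where
      y = witnessY m ; z = witnessZ m q r
      D = lookup d ; Ee = lookup e ; F = lookup f ; M = lookup m ; Q = lookup q ; Rr = lookup r
      local : ∀ a → Bₗ d e f a (y a) (z a) ≈ localB-closed (D a) (Ee a) (F a) (M a) (Q a) (Rr a)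
      local a = begin
        localB (D a) (Ee a) (F a) (x a ≠ᵇ y a) (y a ≠ᵇ z a) (x a ≠ᵇ z a)
          ≡⟨ ≡.cong₂ (λ u (vw : Bool × Bool) → localB (D a) (Ee a) (F a) u (proj₁ vw) (proj₂ vw))
                     x≠y (≡.cong₂ _,_ y≠z x≠z) ⟩
        localB (D a) (Ee a) (F a) (M a) (Q a) (Rr a)
          ≈⟨ ι-localB (D a) (Ee a) (F a) (M a) (Q a) (Rr a) ⟨
        ι (ℕLocalFactor.localB (D a) (Ee a) (F a) (M a) (Q a) (Rr a))
          ≡⟨ ≡.cong ι (localB-pattern (D a) (Ee a) (F a) (M a) (Q a) (Rr a)) ⟩
        ι (ℕLocalFactor.localB-closed (D a) (Ee a) (F a) (M a) (Q a) (Rr a))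
          ≈⟨ ι-𝟙⁴ (D a ≐ M a) (F a ≐ Rr a) ((D a xor F a) ⇒ᵇ Q a) (Q a ⇒ᵇ Ee a) ⟩
        localB-closed (D a) (Ee a) (F a) (M a) (Q a) (Rr a) ∎
        where open Realises (realises m q r mqr a)

    B⊗B-at-witness : ∀ g h i j k l m q r → ℙ s g h i → ℙ s j k l → ℙ s m q r →
      (B g h i ⊗ B j k l) (witnessY m) (witnessZ m q r) ≈ witnessValue g h i j k l m q r
    B⊗B-at-witness g h i j k l m q r ghi jkl mqr = begin
      (B g h i ⊗ B j k l) y z
        ≈⟨ ⊗-⨂ (Bₗ g h i) (Bₗ j k l) (B-⨂ g h i) (B-⨂ j k l) y z ⟩
      ∏ (λ a → ∑ (allFin (s a)) (λ t → Bₗ g h i a (y a) t * Bₗ j k l a t (z a)))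
        ≈⟨ ∏-cong local ⟩
      ∏ (λ a → χ a * ι (localK (s a) ((H a ∧ I a) ∧ K a)))
        ≈⟨ ∏-distrib-* {n} _ _ ⟩
      ∏ χ * ∏ (λ a → ι (localK (s a) ((H a ∧ I a) ∧ K a)))
        ≈⟨ *-cong (trans (∏-distrib-*₄ {n} _ _ _ _)
                         (*-cong (*-cong (*-cong (sym (𝟙-≟ᴱ i j)) (sym (𝟙-≟ᴱ m g))) (sym (𝟙-≟ᴱ r l)))
                                 (sym (trans (𝟙-⊆? q (bracket s g h i k l)) (∏-cong λ a →
                                   reflexive (≡.cong (λ b → 𝟙 (Q a ⇒ᵇ b)) (lookup-bracket s g h i k l a)))))))
                  (sym (trans (ι-kk ((h ∩ i) ∩ k)) (∏-cong λ a →
                    reflexive (≡.cong (λ b → ι (localK (s a) b)) (lookup-hik a))))) ⟩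
      witnessValue g h i j k l m q r ∎
      where
      y = witnessY m ; z = witnessZ m q r
      G = lookup g ; H = lookup h ; I = lookup i ; J = lookup j ; K = lookup k ; L = lookup l
      M = lookup m ; Q = lookup q ; Rr = lookup r
      χ : Fin n → Carrier
      χ a = localIndicator (big (s a)) (G a) (H a) (I a) (J a) (K a) (L a) (M a) (Q a) (Rr a)
      lookup-hik : ∀ a → lookup ((h ∩ i) ∩ k) a ≡ ((H a ∧ I a) ∧ K a)
      lookup-hik a = ≡.trans (lookup-∩ s (h ∩ i) k a) (≡.cong (_∧ K a) (lookup-∩ s h i a))
      local : ∀ a → ∑ (allFin (s a)) (λ t → Bₗ g h i a (y a) t * Bₗ j k l a t (z a))
                    ≈ χ a * ι (localK (s a) ((H a ∧ I a) ∧ K a))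
      local a = begin
        ∑ (allFin (s a)) (λ t → Bₗ g h i a (y a) t * Bₗ j k l a t (z a))
          ≈⟨ ι-localBB (x a) (y a) (z a) (G a) (H a) (I a) (J a) (K a) (L a) ⟨
        ι (localBB (x a) (y a) (z a) (G a) (H a) (I a) (J a) (K a) (L a))
          ≡⟨ ≡.cong ι (localBB-at-points (s2 a) (x a) (G a) (H a) (I a) (J a) (K a) (L a) (M a) (Q a) (Rr a)
                         (ℙ⇒admissible s g h i ghi a) (ℙ⇒admissible s j k l jkl a) (ℙ⇒admissible s m q r mqr a)) ⟩
        ι (localCoefficient (s a) (G a) (H a) (I a) (J a) (K a) (L a) (M a) (Q a) (Rr a))
          ≈⟨ trans (ι-* (ℕLocalFactor.localIndicator (big (s a)) (G a) (H a) (I a) (J a) (K a) (L a) (M a) (Q a) (Rr a))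
                        (localK (s a) ((H a ∧ I a) ∧ K a)))
                   (*-congʳ (ι-𝟙⁴ _ _ _ (Q a ⇒ᵇ bracketᵇ (big (s a)) (G a) (H a) (I a) (K a) (L a)))) ⟩
        χ a * ι (localK (s a) ((H a ∧ I a) ∧ K a)) ∎

    -- At the witness entry only the B_{m,e,r} with e ⊇ q are nonzero, each with value 1.
    expansion-at-witness : ∀ m q r → ℙ s m q r →
      (coeff : E n → E n → E n → Carrier) (F : E n × E n × E n → Mat) →
      (∀ d e f y z → F (d , e , f) y z ≈ coeff d e f * B d e f y z) →
      ΣM ℙlist F (witnessY m) (witnessZ m q r) ≈ ∑⊇ (ℙᵇ m r) (λ e → coeff m e r) q
    expansion-at-witness m q r mqr coeff F F≈ = begin
      ΣM ℙlist F y z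
        ≈⟨ ΣM-ℙlist F y z ⟩
      ∑³ (λ d e f → 𝟙 (P d e f) * F (d , e , f) y z)
        ≈⟨ ∑³-cong (λ d e f → trans (*-congˡ (trans (F≈ d e f y z) (*-congˡ (B-at-witness m q r mqr d e f))))
                                   (to-front _ _ _ _ _ _)) ⟩
      ∑³ (λ d e f → 𝟙 (does (d ≟ᴱ m)) * (𝟙 (does (f ≟ᴱ r)) * H d e f))
        ≈⟨ ∑-cong (allE n) (λ d → trans (∑-cong (allE n) (λ e → sym (*-distribˡ-∑ _ (allE n) _)))
                                        (sym (*-distribˡ-∑ _ (allE n) _))) ⟩
      ∑ (allE n) (λ d → 𝟙 (does (d ≟ᴱ m)) * ∑ (allE n) (λ e → ∑ (allE n) (λ f → 𝟙 (does (f ≟ᴱ r)) * H d e f)))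
        ≈⟨ ∑-allE-δ m _ ⟩
      ∑ (allE n) (λ e → ∑ (allE n) (λ f → 𝟙 (does (f ≟ᴱ r)) * H m e f))
        ≈⟨ ∑-cong (allE n) (λ e → ∑-allE-δ r (H m e)) ⟩
      ∑ (allE n) (λ e → H m e r)
        ≈⟨ ∑-cong (allE n) (λ e → *-congˡ (trans (*-congˡ (trans (*-congʳ m△r⊆q) (*-identityˡ _))) (*-comm _ _))) ⟩
      ∑ (allE n) (λ e → 𝟙 (P m e r) * (𝟙 (does (q ⊆? e)) * coeff m e r)) ∎
      where
      y = witnessY m ; z = witnessZ m q r
      P = λ d e f → does (ℙ? s d e f)
      H : E n → E n → E n → Carrier
      H d e f = 𝟙 (P d e f) * (coeff d e f * (𝟙 (does ((d △ f) ⊆? q)) * 𝟙 (does (q ⊆? e))))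
      m△r⊆q : 𝟙 (does ((m △ r) ⊆? q)) ≈ 1#
      m△r⊆q = reflexive (≡.cong 𝟙 (dec-true ((m △ r) ⊆? q) (proj₁ mqr)))
      to-front : ∀ p c a b d e → p * (c * (((a * b) * d) * e)) ≈ a * (b * (p * (c * (d * e))))
      to-front = solve 6 (λ p c a b d e → p ⊕ (c ⊕ (((a ⊕ b) ⊕ d) ⊕ e))
                                          ⊜ a ⊕ (b ⊕ (p ⊕ (c ⊕ (d ⊕ e))))) refl

    -- F abstracts the summand of the expansion in the theorem: restating that pattern lambda here
    -- would define a different function.
    ∑⊇-coefficients : ∀ g h i j k l m r → ℙ s g h i → ℙ s j k l →
      ∀ coeff (F : E n × E n × E n → Mat) → (∀ d e f y z → F (d , e , f) y z ≈ coeff d e f * B d e f y z) →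
      (B g h i ⊗ B j k l) ≈ₘ ΣM ℙlist F →
      ∀ q → T (ℙᵇ m r q) →
      ∑⊇ (ℙᵇ m r) (λ e → coeff m e r) q ≈ ∑⊇ (ℙᵇ m r) (claimed g h i j k l m r) q
    ∑⊇-coefficients g h i j k l m r ghi jkl coeff F F≈ expansion q mqr? = begin
      ∑⊇ (ℙᵇ m r) (λ e → coeff m e r) q                 ≈⟨ expansion-at-witness m q r mqr coeff F F≈ ⟨
      ΣM ℙlist F (witnessY m) (witnessZ m q r)          ≈⟨ expansion (witnessY m) (witnessZ m q r) ⟨
      (B g h i ⊗ B j k l) (witnessY m) (witnessZ m q r) ≈⟨ B⊗B-at-witness g h i j k l m q r ghi jkl mqr ⟩
      witnessValue g h i j k l m q r                    ≈⟨ ∑⊇-claimed g h i j k l m q r ⟨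
      ∑⊇ (ℙᵇ m r) (claimed g h i j k l m r) q           ∎
      where mqr = from-does (ℙ? s m q r) mqr?

theorem3p23 : {c ℓ : Level} (𝔽 : Field c ℓ) (n : ℕ) → 1 ≤ n →
    (s : Fin n → ℕ) → ((a : Fin n) → 2 ≤ s a) → (x : X n s) →
    (g h i j k l m q r : E n) →
    ℙ s g h i → ℙ s j k l → ℙ s m q r →
    let open Field 𝔽
        open Setup 𝔽 n s x
    in ℙ s g (bracket s g h i k l) l
       × ((coeff : E n → E n → E n → Carrier) →
          ((B g h i ⊗ B j k l) ≈ₘ ΣM ℙlist (λ { (a , b , c′) → coeff a b c′ • B a b c′ })) →
          coeff m q r ≈ (((δ i j * δ m g) * δ q (bracket s g h i k l)) * δ r l) * ι (kk s ((h ∩ i) ∩ k)))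
theorem3p23 𝔽 n _ s s2 x g h i j k l m q r ghi jkl mqr =
  ℙ-bracket s g h i k l ,
  λ coeff expansion →
    superset-inversion (ℙᵇ m r) (λ e → coeff m e r) (claimed g h i j k l m r)
      (∑⊇-coefficients g h i j k l m r ghi jkl coeff _ (λ _ _ _ _ _ → refl) expansion)
      q (ℙ-member s m q r mqr)
  where
  open Field 𝔽 using (commutativeRing; refl)
  open SupersetInversion commutativeRing using (superset-inversion)
  open Entries 𝔽 n s x using (ℙᵇ; claimed; module AtWitness)
  open AtWitness s2 using (∑⊇-coefficients)
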